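{- For every $n\ge 1$ there is a PC formula $\varphi_{n,1}$ of size $O(n)$ and an equivalent URC-irredundant formula $\varphi_{n,2}$ of size $2^{\Omega(n)}$.
   Context: A CNF is a set of clauses; size is the number of clauses. A partial assignment is a set of literals with no complementary pair, identified with their conjunction. Unit resolution derives $C\setminus\{l\}$ from a clause $C\ni l$ and the unit clause $\neg l$; $\vdash_1$ denotes derivability by repeated unit resolution; $\bot$ is the empty clause. $\varphi(\mathbf{x})$ is URC if for every partial assignment $\alpha$ of $\mathbf{x}$, $\varphi\wedge\alpha\models\bot$ implies $\varphi\wedge\alpha\vdash_1\bot$; it is PC if for every partial assignment $\alpha$ and literal $l$ on $\mathbf{x}$ with $\varphi\wedge\alpha\models l$, we have $\varphi\wedge\alpha\vdash_1 l$ or $\varphi\wedge\alpha\vdash_1\bot$. A URC formula is URC-irredundant if removing any single clause either changes the represented function or yields a formula that is not URC. Both formulas are on the same variables (no auxiliary variables). -}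

module Defs where

open import Data.Nat using (ℕ)
open import Data.Bool using (Bool; true; false; not)
open import Data.Fin using (Fin)
open import Data.Fin.Subset using (Subset; _∈_; _-_; ⁅_⁆; ⊥)
open import Data.List using (List; length; removeAt)
open import Data.List.Relation.Unary.All using (All)
open import Data.List.Membership.Propositional renaming (_∈_ to _∈ₗ_)
open import Data.List.Relation.Unary.Unique.Propositional using (Unique)
open import Data.Product using (Σ; _×_; _,_)
open import Data.Sum using (_⊎_)
open import Relation.Nullary using (¬_)
open import Relation.Binary.PropositionalEquality using (_≡_)
import Data.Empty as E

-- A literal on variables Fin m: (x , true) is x, (x , false) is ¬x.
Lit : ℕ → Set
Lit m = Fin m × Bool

neg : ∀ {m} → Lit m → Lit m
neg (x , b) = x , not b

record Clause (m : ℕ) : Set where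
  constructor clause
  field
    pos : Subset m
    negs : Subset m
open Clause public

vars : ∀ {m} → Clause m → Bool → Subset m
vars C true  = pos C
vars C false = negs C

_∈ᶜ_ : ∀ {m} → Lit m → Clause m → Set
(x , b) ∈ᶜ C = x ∈ vars C b

removeLit : ∀ {m} → Lit m → Clause m → Clause m
removeLit (x , true)  C = clause (pos C - x) (negs C)
removeLit (x , false) C = clause (pos C) (negs C - x)

unit : ∀ {m} → Lit m → Clause m
unit (x , true)  = clause ⁅ x ⁆ ⊥
unit (x , false) = clause ⊥ ⁅ x ⁆

emptyClause : ∀ {m} → Clause m
emptyClause = clause ⊥ ⊥

-- A CNF is a set of clauses, represented as a duplicate-free list; size = length.
CNF : ℕ → Set
CNF m = List (Clause m)

IsCNF : ∀ {m} → CNF m → Set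
IsCNF φ = Unique φ

size : ∀ {m} → CNF m → ℕ
size = length

record PartialAssignment (m : ℕ) : Set where
  field
    posA : Subset m
    negA : Subset m
    consistent : ∀ x → x ∈ posA → x ∈ negA → E.⊥
open PartialAssignment public

varsA : ∀ {m} → PartialAssignment m → Bool → Subset m
varsA α true  = posA α
varsA α false = negA α

_∈ᵅ_ : ∀ {m} → Lit m → PartialAssignment m → Set
(x , b) ∈ᵅ α = x ∈ varsA α b

data _∧_⊢₁_ {m} (φ : CNF m) (α : PartialAssignment m) : Clause m → Set where
  fromφ   : ∀ {C} → C ∈ₗ φ → φ ∧ α ⊢₁ C
  fromα   : ∀ {l} → l ∈ᵅ α → φ ∧ α ⊢₁ unit l
  resolve : ∀ {C l} → φ ∧ α ⊢₁ C → l ∈ᶜ C → φ ∧ α ⊢₁ unit (neg l) →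
            φ ∧ α ⊢₁ removeLit l C

Assignment : ℕ → Set
Assignment m = Fin m → Bool

litTrue : ∀ {m} → Assignment m → Lit m → Set
litTrue a (x , b) = a x ≡ b

clauseSat : ∀ {m} → Assignment m → Clause m → Set
clauseSat a C = Σ (Lit _) (λ l → l ∈ᶜ C × litTrue a l)

cnfSat : ∀ {m} → Assignment m → CNF m → Set
cnfSat a φ = All (clauseSat a) φ

extends : ∀ {m} → Assignment m → PartialAssignment m → Set
extends a α = ∀ l → l ∈ᵅ α → litTrue a l

_∧_⊨_ : ∀ {m} → CNF m → PartialAssignment m → Lit m → Set
φ ∧ α ⊨ l = ∀ a → cnfSat a φ → extends a α → litTrue a l

_∧_⊨⊥ : ∀ {m} → CNF m → PartialAssignment m → Set
φ ∧ α ⊨⊥ = ∀ a → cnfSat a φ → extends a α → E.⊥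

URC : ∀ {m} → CNF m → Set
URC φ = ∀ α → φ ∧ α ⊨⊥ → φ ∧ α ⊢₁ emptyClause

PC : ∀ {m} → CNF m → Set
PC φ = ∀ α l → φ ∧ α ⊨ l → (φ ∧ α ⊢₁ unit l) ⊎ (φ ∧ α ⊢₁ emptyClause)

Equivalent : ∀ {m} → CNF m → CNF m → Set
Equivalent φ ψ = ∀ a → (cnfSat a φ → cnfSat a ψ) × (cnfSat a ψ → cnfSat a φ)

URC-irredundant : ∀ {m} → CNF m → Set
URC-irredundant φ = URC φ ×
  (∀ (i : Fin (length φ)) → ¬ Equivalent (removeAt φ i) φ ⊎ ¬ URC (removeAt φ i))

-- Variables w and aᵢ, bᵢ, uᵢ (i < n).  φ₁ = K ∧ ⋀ᵢ Eᵢ with K = w ∨ ¬u₁ ∨ … ∨ ¬uₙ and Eᵢ = ¬aᵢ ∨ uᵢ.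
-- It is PC: given a conflict-free α, unit propagation derives uᵢ from aᵢ or uᵢ, then w once every uᵢ is
-- derived, and ¬uⱼ, ¬aⱼ once ¬w holds and every other uᵢ is derived; every other literal is falsified by
-- a model of φ₁ obtained by completing α with suitable default values.
-- φ₂ splits each Eᵢ on bᵢ into DPᵢ = bᵢ ∨ uᵢ ∨ ¬aᵢ and DNᵢ = ¬bᵢ ∨ uᵢ ∨ ¬aᵢ, and replaces K by the 2ⁿ⁻¹
-- clauses Mₜ = w ∨ ⋁ⱼ ¬xⱼ, where xⱼ is uⱼ or aⱼ according to tⱼ, for the t with the parity of (1,…,1)
-- (so K = M₍₁,…,₁₎).  Each Mₜ follows from K and the Eᵢ, hence φ₂ ≡ φ₁.  φ₂ is URC: if α contains ¬w and
-- one of aⱼ, uⱼ for every j, then either the Mₜ read off from α has the right parity and is falsified,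
-- or flipping a coordinate j with aⱼ ∈ α gives an Mₛ that propagates ¬uⱼ, which clashes with aⱼ via bⱼ.
-- Every clause is needed: DPᵢ, DNᵢ and K are each the only clause falsified by some assignment, and
-- without any other Mₛ the assignment ¬w ∧ ⋀ⱼ xⱼ(s) stays unsatisfiable, yet every remaining clause keeps
-- a satisfied literal or two unassigned ones (two vectors of equal parity differ in two coordinates),
-- so unit resolution is stuck.

module Submission where

open import Defs
open import Data.Bool using (Bool; true; false; not; _xor_; _∨_)
open import Data.Bool.Properties
  using (∨-zeroʳ; not-involutive; not-injective; not-distribʳ-xor; xor-comm; not-¬; ¬-not)
import Data.Bool.Properties as Bool
open import Data.Empty using (⊥; ⊥-elim)
open import Function using (case_of_; id)
open import Data.Fin using (Fin; zero; suc; combine; remQuot; _≟_)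
open import Data.Fin.Properties
  using (suc-injective; ¬∀⟶∃¬; any?; all?; combine-injective; remQuot-combine; combine-remQuot)
open import Data.Fin.Subset using (Subset; _-_; ⁅_⁆; _∪_) renaming (_∈_ to _∈ₛ_)
open import Data.Fin.Subset.Properties
  using (_∈?_; ∉⊥; x∈⁅x⁆; x∈⁅y⁆⇒x≡y; x∈p∪q⁺; x∈p∪q⁻; p─q⊆p; x∈p∧x≢y⇒x∈p-y; ⊆-antisym)
open import Data.List using (List; []; _∷_; _++_; map; foldr; cartesianProduct; allFin; removeAt; length)
import Data.List as List
open import Data.List.Membership.Propositional using () renaming (_∈_ to _∈ₗ_; _∉_ to _∉ₗ_)
open import Data.List.Membership.Propositional.Properties
  using (∈-allFin; ∈-cartesianProduct⁺; ∈-lookup; ∈-map⁺; ∈-map⁻; ∈-++⁺ˡ; ∈-++⁺ʳ; ∈-++⁻)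
open import Data.List.Properties using (length-++; length-map; length-tabulate; length-++-≤ʳ)
open import Data.List.Relation.Unary.All as All using (All)
open import Data.List.Relation.Unary.Any using (here; there)
open import Data.List.Relation.Unary.AllPairs using ([]; _∷_)
open import Data.List.Relation.Unary.Unique.Propositional using (Unique)
import Data.List.Relation.Unary.Unique.Propositional.Properties as Unique
open import Data.Nat using (ℕ; zero; suc; _+_; _*_; _^_; _≤_; z≤n; s≤s)
open import Data.Nat.Properties
  using (+-identityʳ; *-identityʳ; +-monoˡ-≤; *-monoˡ-≤; *-monoʳ-≤; ^-monoˡ-≤; m^n>0; module ≤-Reasoning)
open import Data.Product using (Σ; ∃; ∃₂; _×_; _,_; proj₁; proj₂; uncurry)
open import Data.Sum using (_⊎_; inj₁; inj₂)
open import Data.Vec using (Vec; []; _∷_; lookup; replicate; tabulate; _[_]≔_)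
open import Data.Vec.Base using () renaming (there to thereᵥ)
open import Data.Vec.Relation.Binary.Pointwise.Extensional using (ext; Pointwise-≡⇒≡)
import Data.Vec.Properties as Vec
open import Data.Vec.Properties
  using (∷-injectiveʳ; lookup-replicate; lookup∘tabulate; lookup∘update; lookup∘update′)
open import Relation.Binary.PropositionalEquality
  using (_≡_; _≢_; refl; sym; trans; cong; cong₂; subst; module ≡-Reasoning)
open import Relation.Nullary using (¬_; Dec; yes; no)
open import Relation.Nullary.Decidable using (_×-dec_; _⊎-dec_; _→-dec_; ¬?; does; dec-true; dec-false)

private variable
  m k : ℕ

-- Literals and clauses

infix 30 _⁺ _⁻
_⁺ _⁻ : Fin m → Lit m
x ⁺ = x , true
x ⁻ = x , false

_∉ᶜ_ : Lit m → Clause m → Set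
l ∉ᶜ C = ¬ l ∈ᶜ C

_∉ᵅ_ : Lit m → PartialAssignment m → Set
l ∉ᵅ α = ¬ l ∈ᵅ α

_∈ᵅ?_ : (l : Lit m) (α : PartialAssignment m) → Dec (l ∈ᵅ α)
(x , true)  ∈ᵅ? α = x ∈? posA α
(x , false) ∈ᵅ? α = x ∈? negA α

_⊆ᶜ_ : Clause m → Clause m → Set
C ⊆ᶜ D = ∀ l → l ∈ᶜ C → l ∈ᶜ D

_∈ᶜ?_ : (l : Lit m) (C : Clause m) → Dec (l ∈ᶜ C)
(x , true)  ∈ᶜ? C = x ∈? pos C
(x , false) ∈ᶜ? C = x ∈? negs C

⊆ᶜ-antisym : {C D : Clause m} → C ⊆ᶜ D → D ⊆ᶜ C → C ≡ D
⊆ᶜ-antisym {C = clause p n} {clause p′ n′} C⊆D D⊆C =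
  cong₂ clause (⊆-antisym (λ {x} → C⊆D (x ⁺)) (λ {x} → D⊆C (x ⁺)))
               (⊆-antisym (λ {x} → C⊆D (x ⁻)) (λ {x} → D⊆C (x ⁻)))

∉ᶜ-empty : (l : Lit m) → l ∉ᶜ emptyClause
∉ᶜ-empty (x , true)  = ∉⊥
∉ᶜ-empty (x , false) = ∉⊥

∈ᶜ-unit : (l : Lit m) → l ∈ᶜ unit l
∈ᶜ-unit (x , true)  = x∈⁅x⁆ x
∈ᶜ-unit (x , false) = x∈⁅x⁆ x

∈ᶜ-unit⁻ : {l : Lit m} (k : Lit m) → l ∈ᶜ unit k → l ≡ k
∈ᶜ-unit⁻ {l = x , true}  (y , true)  h = cong _⁺ (x∈⁅y⁆⇒x≡y y h)
∈ᶜ-unit⁻ {l = x , false} (y , false) h = cong _⁻ (x∈⁅y⁆⇒x≡y y h)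
∈ᶜ-unit⁻ {l = x , true}  (y , false) h = ⊥-elim (∉⊥ h)
∈ᶜ-unit⁻ {l = x , false} (y , true)  h = ⊥-elim (∉⊥ h)

x∉p-x : ∀ {n} (p : Subset n) x → ¬ x ∈ₛ p - x
x∉p-x (_ ∷ p) zero    ()
x∉p-x (_ ∷ p) (suc x) (thereᵥ h) = x∉p-x p x h

∈ᶜ-removeLit⁺ : {l k : Lit m} {C : Clause m} → l ∈ᶜ C → l ≢ k → l ∈ᶜ removeLit k C
∈ᶜ-removeLit⁺ {l = x , true}  {y , true}  h l≢k = x∈p∧x≢y⇒x∈p-y h (λ x≡y → l≢k (cong _⁺ x≡y))
∈ᶜ-removeLit⁺ {l = x , false} {y , false} h l≢k = x∈p∧x≢y⇒x∈p-y h (λ x≡y → l≢k (cong _⁻ x≡y))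
∈ᶜ-removeLit⁺ {l = x , true}  {y , false} h _ = h
∈ᶜ-removeLit⁺ {l = x , false} {y , true}  h _ = h

∈ᶜ-removeLit⁻ : {l k : Lit m} {C : Clause m} → l ∈ᶜ removeLit k C → l ∈ᶜ C × l ≢ k
∈ᶜ-removeLit⁻ {l = x , true}  {y , true}  {C} h = p─q⊆p (pos C) ⁅ y ⁆ h  , λ { refl → x∉p-x (pos C) x h }
∈ᶜ-removeLit⁻ {l = x , false} {y , false} {C} h = p─q⊆p (negs C) ⁅ y ⁆ h , λ { refl → x∉p-x (negs C) x h }
∈ᶜ-removeLit⁻ {l = x , true}  {y , false} h = h , λ ()
∈ᶜ-removeLit⁻ {l = x , false} {y , true}  h = h , λ ()

addLit : Lit m → Clause m → Clause m
addLit (x , true)  C = clause (⁅ x ⁆ ∪ pos C) (negs C)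
addLit (x , false) C = clause (pos C) (⁅ x ⁆ ∪ negs C)

clauseOf : List (Lit m) → Clause m
clauseOf = foldr addLit emptyClause

∈ᶜ-addLit-self : (k : Lit m) (C : Clause m) → k ∈ᶜ addLit k C
∈ᶜ-addLit-self (x , true)  C = x∈p∪q⁺ (inj₁ (x∈⁅x⁆ x))
∈ᶜ-addLit-self (x , false) C = x∈p∪q⁺ (inj₁ (x∈⁅x⁆ x))

⊆ᶜ-addLit : (k : Lit m) (C : Clause m) → C ⊆ᶜ addLit k C
⊆ᶜ-addLit (y , true)  C (x , true)  h = x∈p∪q⁺ (inj₂ h)
⊆ᶜ-addLit (y , true)  C (x , false) h = h
⊆ᶜ-addLit (y , false) C (x , true)  h = h
⊆ᶜ-addLit (y , false) C (x , false) h = x∈p∪q⁺ (inj₂ h)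

∈ᶜ-addLit⁻ : {l : Lit m} (k : Lit m) (C : Clause m) → l ∈ᶜ addLit k C → l ≡ k ⊎ l ∈ᶜ C
∈ᶜ-addLit⁻ {l = x , true}  (y , true)  C h with x∈p∪q⁻ ⁅ y ⁆ (pos C) h
... | inj₁ x∈y = inj₁ (cong _⁺ (x∈⁅y⁆⇒x≡y y x∈y))
... | inj₂ x∈C = inj₂ x∈C
∈ᶜ-addLit⁻ {l = x , false} (y , false) C h with x∈p∪q⁻ ⁅ y ⁆ (negs C) h
... | inj₁ x∈y = inj₁ (cong _⁻ (x∈⁅y⁆⇒x≡y y x∈y))
... | inj₂ x∈C = inj₂ x∈C
∈ᶜ-addLit⁻ {l = x , true}  (y , false) C h = inj₂ h
∈ᶜ-addLit⁻ {l = x , false} (y , true)  C h = inj₂ h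

∈ᶜ-clauseOf⁺ : {l : Lit m} {ls : List (Lit m)} → l ∈ₗ ls → l ∈ᶜ clauseOf ls
∈ᶜ-clauseOf⁺ {ls = k ∷ ls} (here refl)   = ∈ᶜ-addLit-self k (clauseOf ls)
∈ᶜ-clauseOf⁺ {l = l} {k ∷ ls} (there h) = ⊆ᶜ-addLit k (clauseOf ls) l (∈ᶜ-clauseOf⁺ h)

∈ᶜ-clauseOf⁻ : {l : Lit m} (ls : List (Lit m)) → l ∈ᶜ clauseOf ls → l ∈ₗ ls
∈ᶜ-clauseOf⁻ {l = l} []       h = ⊥-elim (∉ᶜ-empty l h)
∈ᶜ-clauseOf⁻ {l = l} (k ∷ ls) h with ∈ᶜ-addLit⁻ {l = l} k (clauseOf ls) h
... | inj₁ refl = here refl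
... | inj₂ h′   = there (∈ᶜ-clauseOf⁻ ls h′)

fromLits : (ls : List (Lit m)) → (∀ x → x ⁺ ∈ₗ ls → x ⁻ ∈ₗ ls → ⊥) → PartialAssignment m
fromLits ls noClash = record
  { posA       = pos (clauseOf ls)
  ; negA       = negs (clauseOf ls)
  ; consistent = λ x x⁺ x⁻ → noClash x (∈ᶜ-clauseOf⁻ ls x⁺) (∈ᶜ-clauseOf⁻ ls x⁻)
  }

∈ᵅ-fromLits⁺ : ∀ ls noClash {l : Lit m} → l ∈ₗ ls → l ∈ᵅ fromLits ls noClash
∈ᵅ-fromLits⁺ ls _ {x , true}  l∈ = ∈ᶜ-clauseOf⁺ l∈
∈ᵅ-fromLits⁺ ls _ {x , false} l∈ = ∈ᶜ-clauseOf⁺ l∈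

∈ᵅ-fromLits⁻ : ∀ ls noClash {l : Lit m} → l ∈ᵅ fromLits ls noClash → l ∈ₗ ls
∈ᵅ-fromLits⁻ ls _ {x , true}  l∈ = ∈ᶜ-clauseOf⁻ ls l∈
∈ᵅ-fromLits⁻ ls _ {x , false} l∈ = ∈ᶜ-clauseOf⁻ ls l∈

∈-clauseOf-≡ : {ls ls′ : List (Lit m)} {l : Lit m} → clauseOf ls ≡ clauseOf ls′ → l ∈ₗ ls → l ∈ₗ ls′
∈-clauseOf-≡ {ls′ = ls′} {l} eq l∈ = ∈ᶜ-clauseOf⁻ ls′ (subst (l ∈ᶜ_) eq (∈ᶜ-clauseOf⁺ l∈))

clauseOf-sat : {τ : Assignment m} (ls : List (Lit m)) {l : Lit m} → l ∈ₗ ls → litTrue τ l →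
               clauseSat τ (clauseOf ls)
clauseOf-sat _ l∈ls l-true = _ , ∈ᶜ-clauseOf⁺ l∈ls , l-true

clauseOf-sat⁻ : {τ : Assignment m} (ls : List (Lit m)) → clauseSat τ (clauseOf ls) →
                ∃ λ l → l ∈ₗ ls × litTrue τ l
clauseOf-sat⁻ ls (l , l∈C , l-true) = l , ∈ᶜ-clauseOf⁻ ls l∈C , l-true

extends-falsifies : {τ : Assignment m} {α : PartialAssignment m} (ls : List (Lit m)) →
                    extends τ α → (∀ l → l ∈ₗ ls → neg l ∈ᵅ α) → ¬ clauseSat τ (clauseOf ls)
extends-falsifies ls τ-extends negated sat with clauseOf-sat⁻ ls sat
... | (x , c) , l∈ , l-true = not-¬ l-true (τ-extends (x , not c) (negated (x , c) l∈))

allLits : (m : ℕ) → List (Lit m)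
allLits m = cartesianProduct (allFin m) (true ∷ false ∷ [])

∈-allLits : (l : Lit m) → l ∈ₗ allLits m
∈-allLits (x , true)  = ∈-cartesianProduct⁺ (∈-allFin x) (here refl)
∈-allLits (x , false) = ∈-cartesianProduct⁺ (∈-allFin x) (there (here refl))

-- Unit resolution

module _ {m} {φ : CNF m} {α : PartialAssignment m} where

  Refuted : Lit m → Set
  Refuted l = φ ∧ α ⊢₁ unit (neg l)

  private
    Extra : Clause m → Clause m → Lit m → Set
    Extra C D l = l ∈ᶜ C × l ∉ᶜ D

    drop-pending : {C D : Clause m} {k : Lit m} {ls : List (Lit m)} → ¬ Extra C D k →
                   (∀ l → Extra C D l → l ∈ₗ k ∷ ls) → ∀ l → Extra C D l → l ∈ₗ ls
    drop-pending ¬extra pending l extra with pending l extra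
    ... | here refl = ⊥-elim (¬extra extra)
    ... | there p   = p

    resolve-all : ∀ ls {C D : Clause m} → φ ∧ α ⊢₁ C → D ⊆ᶜ C → (∀ l → Extra C D l → Refuted l) →
                  (∀ l → Extra C D l → l ∈ₗ ls) → φ ∧ α ⊢₁ D
    resolve-all [] {C} {D} ⊢C D⊆C _ pending = subst (φ ∧ α ⊢₁_) (⊆ᶜ-antisym C⊆D D⊆C) ⊢C
      where
      C⊆D : C ⊆ᶜ D
      C⊆D l l∈C with l ∈ᶜ? D
      ... | yes l∈D = l∈D
      ... | no l∉D with pending l (l∈C , l∉D)
      ... | ()
    resolve-all (k ∷ ls) {C} {D} ⊢C D⊆C refute pending with k ∈ᶜ? C | k ∈ᶜ? D
    ... | no k∉C  | _       = resolve-all ls ⊢C D⊆C refute (drop-pending (λ e → k∉C (proj₁ e)) pending)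
    ... | yes _   | yes k∈D = resolve-all ls ⊢C D⊆C refute (drop-pending (λ e → proj₂ e k∈D) pending)
    ... | yes k∈C | no k∉D  =
      resolve-all ls (resolve ⊢C k∈C (refute k (k∈C , k∉D))) D⊆C′
        (λ l (l∈C′ , l∉D) → refute l (proj₁ (∈ᶜ-removeLit⁻ {l = l} l∈C′) , l∉D))
        (drop-pending (λ e → proj₂ (∈ᶜ-removeLit⁻ {l = k} (proj₁ e)) refl) pending′)
      where
      D⊆C′ : D ⊆ᶜ removeLit k C
      D⊆C′ l l∈D = ∈ᶜ-removeLit⁺ {l = l} (D⊆C l l∈D) (λ { refl → k∉D l∈D })
      pending′ : ∀ l → Extra (removeLit k C) D l → l ∈ₗ k ∷ ls
      pending′ l (l∈C′ , l∉D) = pending l (proj₁ (∈ᶜ-removeLit⁻ {l = l} l∈C′) , l∉D)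

  ⊢₁-subclause : {C D : Clause m} → φ ∧ α ⊢₁ C → D ⊆ᶜ C →
                 (∀ l → l ∈ᶜ C → l ∉ᶜ D → Refuted l) → φ ∧ α ⊢₁ D
  ⊢₁-subclause ⊢C D⊆C refute =
    resolve-all (allLits _) ⊢C D⊆C (λ l (l∈C , l∉D) → refute l l∈C l∉D) (λ l _ → ∈-allLits l)

  ⊢₁-contradiction : (k : Lit m) → φ ∧ α ⊢₁ unit k → Refuted k → φ ∧ α ⊢₁ emptyClause
  ⊢₁-contradiction k ⊢k refuted = ⊢₁-subclause ⊢k (λ l l∈∅ → ⊥-elim (∉ᶜ-empty l l∈∅))
    (λ l l∈k _ → subst Refuted (sym (∈ᶜ-unit⁻ k l∈k)) refuted)

  ⊢₁-propagate : (ls : List (Lit m)) {k : Lit m} → clauseOf ls ∈ₗ φ → k ∈ₗ ls →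
                 (∀ l → l ∈ₗ ls → l ≢ k → Refuted l) → φ ∧ α ⊢₁ unit k
  ⊢₁-propagate ls {k} C∈φ k∈ls refute = ⊢₁-subclause (fromφ C∈φ) unit⊆C
    (λ l l∈C l∉k → refute l (∈ᶜ-clauseOf⁻ ls l∈C) (λ { refl → l∉k (∈ᶜ-unit l) }))
    where
    unit⊆C : unit k ⊆ᶜ clauseOf ls
    unit⊆C l l∈k with ∈ᶜ-unit⁻ {l = l} k l∈k
    ... | refl = ∈ᶜ-clauseOf⁺ k∈ls

  ⊢₁-falsify : (ls : List (Lit m)) → clauseOf ls ∈ₗ φ → (∀ l → l ∈ₗ ls → Refuted l) →
               φ ∧ α ⊢₁ emptyClause
  ⊢₁-falsify ls C∈φ refute = ⊢₁-subclause (fromφ C∈φ) (λ l l∈∅ → ⊥-elim (∉ᶜ-empty l l∈∅))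
    (λ l l∈C _ → refute l (∈ᶜ-clauseOf⁻ ls l∈C))

∉ᵅ-neg : (α : PartialAssignment m) (l : Lit m) → l ∈ᵅ α → neg l ∉ᵅ α
∉ᵅ-neg α (x , true)  x∈ ¬x∈ = consistent α x x∈ ¬x∈
∉ᵅ-neg α (x , false) ¬x∈ x∈ = consistent α x x∈ ¬x∈

module _ {m} (α : PartialAssignment m) where

  Unassigned : Lit m → Set
  Unassigned l = l ∉ᵅ α × neg l ∉ᵅ α

  -- A resolvent against α only loses a literal falsified by α, so this is preserved and ⊥ never derived.
  Guarded : Clause m → Set
  Guarded C = (∃ λ l → l ∈ᶜ C × l ∈ᵅ α)
            ⊎ (∃₂ λ l l′ → l ≢ l′ × l ∈ᶜ C × l′ ∈ᶜ C × Unassigned l × Unassigned l′)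

  module _ {φ : CNF m} (guarded : ∀ C → C ∈ₗ φ → Guarded C) where

    ⊢₁-Guarded : {C : Clause m} → φ ∧ α ⊢₁ C → Guarded C
    ⊢₁-Guarded (fromφ C∈φ)       = guarded _ C∈φ
    ⊢₁-Guarded (fromα {l} l∈α)   = inj₁ (l , ∈ᶜ-unit l , l∈α)
    ⊢₁-Guarded (resolve {C} {l} ⊢C l∈C ⊢¬l) with ⊢₁-Guarded ⊢¬l
    ... | inj₂ (k , k′ , k≢k′ , k∈ , k′∈ , _) =
      ⊥-elim (k≢k′ (trans (∈ᶜ-unit⁻ (neg l) k∈) (sym (∈ᶜ-unit⁻ (neg l) k′∈))))
    ... | inj₁ (k , k∈ , k∈α) with ∈ᶜ-unit⁻ {l = k} (neg l) k∈ | ⊢₁-Guarded ⊢C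
    ...   | refl | inj₁ (t , t∈C , t∈α) =
      inj₁ (t , ∈ᶜ-removeLit⁺ {l = t} t∈C (λ { refl → ∉ᵅ-neg α t t∈α k∈α }) , t∈α)
    ...   | refl | inj₂ (t , t′ , t≢t′ , t∈C , t′∈C , un , un′) =
      inj₂ (t , t′ , t≢t′ , ∈ᶜ-removeLit⁺ {l = t} t∈C (λ { refl → proj₂ un k∈α }) ,
            ∈ᶜ-removeLit⁺ {l = t′} t′∈C (λ { refl → proj₂ un′ k∈α }) , un , un′)

    ⊬₁-empty : ¬ φ ∧ α ⊢₁ emptyClause
    ⊬₁-empty ⊢∅ with ⊢₁-Guarded ⊢∅
    ... | inj₁ (l , l∈∅ , _)     = ∉ᶜ-empty l l∈∅
    ... | inj₂ (l , _ , _ , l∈∅ , _) = ∉ᶜ-empty l l∈∅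

module Completion {m} (α : PartialAssignment m) where

  data Status (x : Fin m) : Set where
    assigned   : ∀ c → (x , c) ∈ᵅ α → Status x
    unassigned : x ⁺ ∉ᵅ α → x ⁻ ∉ᵅ α → Status x

  status : ∀ x → Status x
  status x with x ∈? posA α | x ∈? negA α
  ... | yes x⁺ | _      = assigned true x⁺
  ... | no _   | yes x⁻ = assigned false x⁻
  ... | no x⁺∉ | no x⁻∉ = unassigned x⁺∉ x⁻∉

  valueOr : Bool → Fin m → Bool
  valueOr d x with status x
  ... | assigned c _   = c
  ... | unassigned _ _ = d

  valueOr-agrees : ∀ d x c → (x , c) ∈ᵅ α → valueOr d x ≡ c
  valueOr-agrees d x c x∈ with status x
  ... | unassigned x⁺∉ x⁻∉ = ⊥-elim (unassigned-∉ c x⁺∉ x⁻∉ x∈)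
    where
    unassigned-∉ : ∀ c → x ⁺ ∉ᵅ α → x ⁻ ∉ᵅ α → (x , c) ∉ᵅ α
    unassigned-∉ true  x⁺∉ _ = x⁺∉
    unassigned-∉ false _ x⁻∉ = x⁻∉
  ... | assigned c′ x∈′ with c′ | c
  ...   | true  | true  = refl
  ...   | false | false = refl
  ...   | true  | false = ⊥-elim (consistent α x x∈′ x∈)
  ...   | false | true  = ⊥-elim (consistent α x x∈ x∈′)

  valueOr-avoids : ∀ x c → (x , c) ∉ᵅ α → valueOr (not c) x ≡ not c
  valueOr-avoids x c x∉ with status x
  ... | unassigned _ _ = refl
  ... | assigned c′ x∈ with c′ | c
  ...   | true  | false = refl
  ...   | false | true  = refl
  ...   | true  | true  = ⊥-elim (x∉ x∈)
  ...   | false | false = ⊥-elim (x∉ x∈)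

  valueOr-unassigned : ∀ d x → x ⁺ ∉ᵅ α → x ⁻ ∉ᵅ α → valueOr d x ≡ d
  valueOr-unassigned d x x⁺∉ x⁻∉ with status x
  ... | unassigned _ _   = refl
  ... | assigned true  x⁺ = ⊥-elim (x⁺∉ x⁺)
  ... | assigned false x⁻ = ⊥-elim (x⁻∉ x⁻)

  valueOr-true : ∀ d x → valueOr d x ≡ true → x ⁺ ∈ᵅ α ⊎ d ≡ true
  valueOr-true d x eq with status x
  ... | assigned true x⁺ = inj₁ x⁺
  ... | unassigned _ _   = inj₂ eq

  valueOr-false : ∀ x → x ⁺ ∉ᵅ α → valueOr false x ≡ false
  valueOr-false x x∉ = valueOr-avoids x true x∉

  override : Assignment m → Assignment m
  override δ x = valueOr (δ x) x

  override-extends : ∀ δ → extends (override δ) α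
  override-extends δ (x , c) x∈ = valueOr-agrees (δ x) x c x∈

module _ {A : Set} where

  ∈-removeAt⁻ : (xs : List A) (i : Fin (length xs)) {y : A} → y ∈ₗ removeAt xs i → y ∈ₗ xs
  ∈-removeAt⁻ (x ∷ xs) zero    y∈      = there y∈
  ∈-removeAt⁻ (x ∷ xs) (suc i) (here e) = here e
  ∈-removeAt⁻ (x ∷ xs) (suc i) (there y∈) = there (∈-removeAt⁻ xs i y∈)

  ∈-removeAt⁺ : (xs : List A) (i : Fin (length xs)) {y : A} → y ∈ₗ xs → y ≢ List.lookup xs i →
                y ∈ₗ removeAt xs i
  ∈-removeAt⁺ (x ∷ xs) zero    (here refl) y≢x = ⊥-elim (y≢x refl)
  ∈-removeAt⁺ (x ∷ xs) zero    (there y∈)  _   = y∈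
  ∈-removeAt⁺ (x ∷ xs) (suc i) (here e)    _   = here e
  ∈-removeAt⁺ (x ∷ xs) (suc i) (there y∈)  y≢  = there (∈-removeAt⁺ xs i y∈ y≢)

  lookup∉removeAt : {xs : List A} → Unique xs → (i : Fin (length xs)) → List.lookup xs i ∉ₗ removeAt xs i
  lookup∉removeAt (x∉xs ∷ _)  zero    x∈xs        = All.lookup x∉xs x∈xs refl
  lookup∉removeAt {x ∷ xs} (x∉xs ∷ _) (suc i) (here e) = All.lookup x∉xs (∈-lookup i) (sym e)
  lookup∉removeAt (_ ∷ uxs)   (suc i) (there h)   = lookup∉removeAt uxs i h

¬Equivalent-removeAt : {φ : CNF m} (τ : Assignment m) → Unique φ → (i : Fin (length φ)) →
                       (∀ C → C ∈ₗ φ → C ≢ List.lookup φ i → clauseSat τ C) →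
                       ¬ clauseSat τ (List.lookup φ i) → ¬ Equivalent (removeAt φ i) φ
¬Equivalent-removeAt {φ = φ} τ uφ i sat unsat equiv =
  unsat (All.lookup (proj₁ (equiv τ) (All.tabulate satRemoved)) (∈-lookup i))
  where
  satRemoved : ∀ {C} → C ∈ₗ removeAt φ i → clauseSat τ C
  satRemoved C∈ = sat _ (∈-removeAt⁻ φ i C∈) (λ { refl → lookup∉removeAt uφ i C∈ })

-- Boolean vectors by parity

parity : Vec Bool k → Bool
parity []      = false
parity (x ∷ t) = x xor parity t

vecsOfParity : (k : ℕ) → Bool → List (Vec Bool k)
vecsOfParity zero    true  = []
vecsOfParity zero    false = [] ∷ []
vecsOfParity (suc k) p     = map (false ∷_) (vecsOfParity k p) ++ map (true ∷_) (vecsOfParity k (not p))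

∈-vecsOfParity⁺ : (t : Vec Bool k) → t ∈ₗ vecsOfParity k (parity t)
∈-vecsOfParity⁺ []          = here refl
∈-vecsOfParity⁺ (false ∷ t) = ∈-++⁺ˡ (∈-map⁺ (false ∷_) (∈-vecsOfParity⁺ t))
∈-vecsOfParity⁺ {suc k} (true ∷ t) =
  ∈-++⁺ʳ (map (false ∷_) (vecsOfParity k (not (parity t))))
         (∈-map⁺ (true ∷_) (subst (λ p → t ∈ₗ vecsOfParity k p) (sym (not-involutive _)) (∈-vecsOfParity⁺ t)))

∈-vecsOfParity⁻ : (p : Bool) {t : Vec Bool k} → t ∈ₗ vecsOfParity k p → parity t ≡ p
∈-vecsOfParity⁻ {zero}  false (here refl) = refl
∈-vecsOfParity⁻ {suc k} p t∈ with ∈-++⁻ (map (false ∷_) (vecsOfParity k p)) t∈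
... | inj₁ t∈₀ with ∈-map⁻ (false ∷_) t∈₀
...   | t , t∈′ , refl = ∈-vecsOfParity⁻ p t∈′
∈-vecsOfParity⁻ {suc k} p t∈ | inj₂ t∈₁ with ∈-map⁻ (true ∷_) t∈₁
...   | t , t∈′ , refl = trans (cong not (∈-vecsOfParity⁻ (not p) t∈′)) (not-involutive p)

vecsOfParity-unique : (k : ℕ) (p : Bool) → Unique (vecsOfParity k p)
vecsOfParity-unique zero    true  = []
vecsOfParity-unique zero    false = All.[] ∷ []
vecsOfParity-unique (suc k) p =
  Unique.++⁺ (Unique.map⁺ ∷-injectiveʳ (vecsOfParity-unique k p))
             (Unique.map⁺ ∷-injectiveʳ (vecsOfParity-unique k (not p))) disjoint
  where
  disjoint : ∀ {t} → ¬ (t ∈ₗ map (false ∷_) (vecsOfParity k p) × t ∈ₗ map (true ∷_) (vecsOfParity k (not p)))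
  disjoint (t∈₀ , t∈₁) with ∈-map⁻ (false ∷_) t∈₀ | ∈-map⁻ (true ∷_) t∈₁
  ... | _ , _ , refl | _ , _ , ()

length-vecsOfParity : (k : ℕ) (p : Bool) → length (vecsOfParity (suc k) p) ≡ 2 ^ k
length-vecsOfParity zero    true  = refl
length-vecsOfParity zero    false = refl
length-vecsOfParity (suc k) p = begin
  length (map (false ∷_) (vecsOfParity (suc k) p) ++ map (true ∷_) (vecsOfParity (suc k) (not p)))
    ≡⟨ length-++ (map (false ∷_) (vecsOfParity (suc k) p)) ⟩
  length (map (false ∷_) (vecsOfParity (suc k) p)) + length (map (true ∷_) (vecsOfParity (suc k) (not p)))
    ≡⟨ cong₂ _+_ (length-map _ (vecsOfParity (suc k) p)) (length-map _ (vecsOfParity (suc k) (not p))) ⟩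
  length (vecsOfParity (suc k) p) + length (vecsOfParity (suc k) (not p))
    ≡⟨ cong₂ _+_ (length-vecsOfParity k p) (length-vecsOfParity k (not p)) ⟩
  2 ^ k + 2 ^ k
    ≡⟨ cong (2 ^ k +_) (sym (+-identityʳ (2 ^ k))) ⟩
  2 ^ suc k ∎
  where open ≡-Reasoning

parity-[]≔true : (t : Vec Bool k) (j : Fin k) → lookup t j ≡ false → parity (t [ j ]≔ true) ≡ not (parity t)
parity-[]≔true (false ∷ t) zero    refl = refl
parity-[]≔true (x ∷ t)     (suc j) tj   =
  trans (cong (x xor_) (parity-[]≔true t j tj)) (sym (not-distribʳ-xor x (parity t)))

∃-false : (t : Vec Bool k) → t ≢ replicate k true → ∃ λ j → lookup t j ≡ false
∃-false []          t≢1 = ⊥-elim (t≢1 refl)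
∃-false (false ∷ t) _   = zero , refl
∃-false (true ∷ t)  t≢1 with ∃-false t (λ t≡1 → t≢1 (cong (true ∷_) t≡1))
... | j , tj = suc j , tj

∃-difference : (t s : Vec Bool k) → t ≢ s → ∃ λ j → lookup t j ≢ lookup s j
∃-difference []      []      t≢s = ⊥-elim (t≢s refl)
∃-difference (x ∷ t) (y ∷ s) t≢s with x Bool.≟ y
... | no x≢y    = zero , x≢y
... | yes refl with ∃-difference t s (λ t≡s → t≢s (cong (x ∷_) t≡s))
...   | j , d = suc j , d

xor-cancelˡ : ∀ x {a b} → x xor a ≡ x xor b → a ≡ b
xor-cancelˡ false eq = eq
xor-cancelˡ true  eq = not-injective eq

xor-cancelʳ : ∀ {x y} a → x xor a ≡ y xor a → x ≡ y
xor-cancelʳ {x} {y} a eq = xor-cancelˡ a (trans (xor-comm a x) (trans eq (xor-comm y a)))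

∃₂-differences : (t s : Vec Bool k) → parity t ≡ parity s → t ≢ s →
                 ∃₂ λ j j′ → j ≢ j′ × lookup t j ≢ lookup s j × lookup t j′ ≢ lookup s j′
∃₂-differences []      []      _  t≢s = ⊥-elim (t≢s refl)
∃₂-differences (x ∷ t) (y ∷ s) eq t≢s with x Bool.≟ y
... | yes refl with ∃₂-differences t s (xor-cancelˡ x eq) (λ t≡s → t≢s (cong (x ∷_) t≡s))
...   | j , j′ , j≢j′ , d , d′ = suc j , suc j′ , (λ e → j≢j′ (suc-injective e)) , d , d′
∃₂-differences (x ∷ t) (y ∷ s) eq t≢s | no x≢y with ∃-difference t s (λ { refl → x≢y (xor-cancelʳ (parity t) eq) })
...   | j , d = zero , suc j , (λ ()) , x≢y , d

-- The formulas φ₁ and φ₂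

pattern kA = zero
pattern kB = suc zero
pattern kU = suc (suc zero)

kind : Bool → Fin 3
kind true  = kU
kind false = kA

kB≢kind : ∀ b → kB ≢ kind b
kB≢kind true  ()
kB≢kind false ()

kind-injective : ∀ {b c} → kind b ≡ kind c → b ≡ c
kind-injective {true}  {true}  _ = refl
kind-injective {false} {false} _ = refl

module Construction (n : ℕ) where

  numVars : ℕ
  numVars = suc (n * 3)

  W : Fin numVars
  W = zero

  var : Fin n → Fin 3 → Fin numVars
  var i k = suc (combine i k)

  A B U : Fin n → Fin numVars
  A i = var i kA
  B i = var i kB
  U i = var i kU

  var-injective : ∀ {i j k k′} → var i k ≡ var j k′ → i ≡ j × k ≡ k′
  var-injective {i} {j} {k} {k′} e = combine-injective i k j k′ (suc-injective e)

  W≢var : ∀ {i k} → W ≢ var i k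
  W≢var ()

  allTrue : Vec Bool n
  allTrue = replicate n true

  pick : Vec Bool n → Fin n → Fin numVars
  pick t j = var j (kind (lookup t j))

  pick-allTrue : ∀ j → pick allTrue j ≡ U j
  pick-allTrue j = cong (λ b → var j (kind b)) (lookup-replicate j true)

  E-lits DP-lits DN-lits : Fin n → List (Lit numVars)
  E-lits  i = U i ⁺ ∷ A i ⁻ ∷ []
  DP-lits i = B i ⁺ ∷ U i ⁺ ∷ A i ⁻ ∷ []
  DN-lits i = B i ⁻ ∷ U i ⁺ ∷ A i ⁻ ∷ []

  M-lits : Vec Bool n → List (Lit numVars)
  M-lits t = W ⁺ ∷ map (λ j → pick t j ⁻) (allFin n)

  E DP DN : Fin n → Clause numVars
  E  i = clauseOf (E-lits i)
  DP i = clauseOf (DP-lits i)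
  DN i = clauseOf (DN-lits i)

  M : Vec Bool n → Clause numVars
  M t = clauseOf (M-lits t)

  K : Clause numVars
  K = M allTrue

  data Code : Set where
    dp dn : Fin n → Code
    mt    : Vec Bool n → Code

  lits : Code → List (Lit numVars)
  lits (dp i) = DP-lits i
  lits (dn i) = DN-lits i
  lits (mt t) = M-lits t

  ⟦_⟧ : Code → Clause numVars
  ⟦ c ⟧ = clauseOf (lits c)

  codes : List Code
  codes = map dp (allFin n) ++ map dn (allFin n) ++ map mt (vecsOfParity n (parity allTrue))

  φ₁ φ₂ : CNF numVars
  φ₁ = K ∷ map E (allFin n)
  φ₂ = map ⟦_⟧ codes

  E∈φ₁ : ∀ i → E i ∈ₗ φ₁
  E∈φ₁ i = there (∈-map⁺ E (∈-allFin i))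

  dp∈codes : ∀ i → dp i ∈ₗ codes
  dp∈codes i = ∈-++⁺ˡ (∈-map⁺ dp (∈-allFin i))

  dn∈codes : ∀ i → dn i ∈ₗ codes
  dn∈codes i = ∈-++⁺ʳ (map dp (allFin n)) (∈-++⁺ˡ (∈-map⁺ dn (∈-allFin i)))

  mt∈codes : ∀ t → parity t ≡ parity allTrue → mt t ∈ₗ codes
  mt∈codes t t-even = ∈-++⁺ʳ (map dp (allFin n)) (∈-++⁺ʳ (map dn (allFin n))
                        (∈-map⁺ mt (subst (λ p → t ∈ₗ vecsOfParity n p) t-even (∈-vecsOfParity⁺ t))))

  mt∈codes⁻ : ∀ {t} → mt t ∈ₗ codes → parity t ≡ parity allTrue
  mt∈codes⁻ t∈ with ∈-++⁻ (map dp (allFin n)) t∈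
  ... | inj₁ t∈dp with ∈-map⁻ dp t∈dp
  ...   | _ , _ , ()
  mt∈codes⁻ t∈ | inj₂ t∈′ with ∈-++⁻ (map dn (allFin n)) t∈′
  ... | inj₁ t∈dn with ∈-map⁻ dn t∈dn
  ...   | _ , _ , ()
  mt∈codes⁻ t∈ | inj₂ _ | inj₂ t∈mt with ∈-map⁻ mt t∈mt
  ...   | _ , t∈vecs , refl = ∈-vecsOfParity⁻ _ t∈vecs

  DP∈φ₂ : ∀ i → DP i ∈ₗ φ₂
  DP∈φ₂ i = ∈-map⁺ ⟦_⟧ (dp∈codes i)

  DN∈φ₂ : ∀ i → DN i ∈ₗ φ₂
  DN∈φ₂ i = ∈-map⁺ ⟦_⟧ (dn∈codes i)

  M∈φ₂ : ∀ t → parity t ≡ parity allTrue → M t ∈ₗ φ₂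
  M∈φ₂ t t-even = ∈-map⁺ ⟦_⟧ (mt∈codes t t-even)

  pick∈M : ∀ t j → pick t j ⁻ ∈ₗ M-lits t
  pick∈M t j = there (∈-map⁺ _ (∈-allFin j))

  B⁺-owner : ∀ {i} c → B i ⁺ ∈ₗ lits c → c ≡ dp i
  B⁺-owner (dp j) (here e)                 = cong dp (sym (proj₁ (var-injective (cong proj₁ e))))
  B⁺-owner (dp j) (there (here e))         with () ← proj₂ (var-injective (cong proj₁ e))
  B⁺-owner (dp j) (there (there (here ())))
  B⁺-owner (dn j) (there (here e))         with () ← proj₂ (var-injective (cong proj₁ e))
  B⁺-owner (dn j) (there (there (here ())))
  B⁺-owner (mt t) (there l∈) with ∈-map⁻ _ l∈
  ... | _ , _ , ()

  B⁻-owner : ∀ {i} c → B i ⁻ ∈ₗ lits c → c ≡ dn i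
  B⁻-owner (dn j) (here e)                 = cong dn (sym (proj₁ (var-injective (cong proj₁ e))))
  B⁻-owner (dn j) (there (there (here e))) with () ← proj₂ (var-injective (cong proj₁ e))
  B⁻-owner (dp j) (there (there (here e))) with () ← proj₂ (var-injective (cong proj₁ e))
  B⁻-owner (mt t) (here ())
  B⁻-owner (mt t) (there l∈) with ∈-map⁻ _ l∈
  ... | j , _ , e = ⊥-elim (kB≢kind _ (proj₂ (var-injective (cong proj₁ e))))

  W⁺-owner : ∀ c → W ⁺ ∈ₗ lits c → ∃ λ t → c ≡ mt t
  W⁺-owner (mt t) _ = t , refl
  W⁺-owner (dp j) (there (here e))                  = ⊥-elim (W≢var (cong proj₁ e))
  W⁺-owner (dp j) (there (there (here ())))
  W⁺-owner (dp j) (there (there (there ())))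
  W⁺-owner (dn j) (there (here e))                  = ⊥-elim (W≢var (cong proj₁ e))
  W⁺-owner (dn j) (there (there (here ())))
  W⁺-owner (dn j) (there (there (there ())))

  pick⁻∈M : ∀ t t′ j → pick t j ⁻ ∈ₗ M-lits t′ → lookup t j ≡ lookup t′ j
  pick⁻∈M t t′ j (there l∈) with ∈-map⁻ _ l∈
  ... | j′ , _ , e with var-injective (cong proj₁ e)
  ...   | refl , k≡k′ = kind-injective k≡k′

  ∈-⟦⟧-≡ : ∀ c c′ {l} → ⟦ c ⟧ ≡ ⟦ c′ ⟧ → l ∈ₗ lits c → l ∈ₗ lits c′
  ∈-⟦⟧-≡ c c′ = ∈-clauseOf-≡ {ls = lits c} {ls′ = lits c′}

  ⟦⟧-injective : ∀ {c c′} → ⟦ c ⟧ ≡ ⟦ c′ ⟧ → c ≡ c′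
  ⟦⟧-injective {dp i} {c′} e = sym (B⁺-owner c′ (∈-⟦⟧-≡ (dp i) c′ e (here refl)))
  ⟦⟧-injective {dn i} {c′} e = sym (B⁻-owner c′ (∈-⟦⟧-≡ (dn i) c′ e (here refl)))
  ⟦⟧-injective {mt t} {c′} e with W⁺-owner c′ (∈-⟦⟧-≡ (mt t) c′ e (here refl))
  ... | t′ , refl = cong mt (Pointwise-≡⇒≡ (ext λ j → pick⁻∈M t t′ j (∈-⟦⟧-≡ (mt t) (mt t′) e (pick∈M t j))))

  codes-unique : Unique codes
  codes-unique =
    Unique.++⁺ (Unique.map⁺ dp-injective (Unique.allFin⁺ n))
      (Unique.++⁺ (Unique.map⁺ dn-injective (Unique.allFin⁺ n))
                  (Unique.map⁺ mt-injective (vecsOfParity-unique n _)) dn∉mt)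
      dp∉dn,mt
    where
    dp-injective : ∀ {i j} → dp i ≡ dp j → i ≡ j
    dp-injective refl = refl
    dn-injective : ∀ {i j} → dn i ≡ dn j → i ≡ j
    dn-injective refl = refl
    mt-injective : ∀ {t s} → mt t ≡ mt s → t ≡ s
    mt-injective refl = refl
    dn∉mt : ∀ {c} → ¬ (c ∈ₗ map dn (allFin n) × c ∈ₗ map mt (vecsOfParity n _))
    dn∉mt (c∈₁ , c∈₂) with ∈-map⁻ dn c∈₁ | ∈-map⁻ mt c∈₂
    ... | _ , _ , refl | _ , _ , ()
    dp∉dn,mt : ∀ {c} → ¬ (c ∈ₗ map dp (allFin n) × c ∈ₗ map dn (allFin n) ++ map mt (vecsOfParity n _))
    dp∉dn,mt (c∈₁ , c∈₂) with ∈-map⁻ dp c∈₁ | ∈-++⁻ (map dn (allFin n)) c∈₂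
    ... | _ , _ , refl | inj₁ c∈ with ∈-map⁻ dn c∈
    ...   | _ , _ , ()
    dp∉dn,mt (c∈₁ , c∈₂) | _ , _ , refl | inj₂ c∈ with ∈-map⁻ mt c∈
    ...   | _ , _ , ()

  φ₂-unique : Unique φ₂
  φ₂-unique = Unique.map⁺ ⟦⟧-injective codes-unique

  φ₁-unique : Unique φ₁
  φ₁-unique = All.tabulate K≢E ∷ Unique.map⁺ E-injective (Unique.allFin⁺ n)
    where
    E-injective : ∀ {i j} → E i ≡ E j → i ≡ j
    E-injective {i} {j} e with ∈-clauseOf-≡ {ls = E-lits i} {ls′ = E-lits j} e (there (here refl))
    ... | there (here e′) = proj₁ (var-injective (cong proj₁ e′))
    K≢E : ∀ {C} → C ∈ₗ map E (allFin n) → K ≢ C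
    K≢E C∈ K≡C with ∈-map⁻ E C∈
    ... | i , _ , refl with ∈-clauseOf-≡ {ls = M-lits allTrue} {ls′ = E-lits i} K≡C (here refl)
    ...   | here e             = W≢var (cong proj₁ e)
    ...   | there (here ())
    ...   | there (there ())

  -- The Boolean function represented by both φ₁ and φ₂.
  IsModel : Assignment numVars → Set
  IsModel τ = (∀ i → τ (A i) ≡ true → τ (U i) ≡ true) × ((∀ i → τ (U i) ≡ true) → τ W ≡ true)

  module _ {τ : Assignment numVars} where

    A→U-sat : IsModel τ → ∀ {i} ls → U i ⁺ ∈ₗ ls → A i ⁻ ∈ₗ ls → clauseSat τ (clauseOf ls)
    A→U-sat (a→u , _) {i} ls U∈ A∈ with τ (A i) in eq
    ... | true  = clauseOf-sat ls U∈ (a→u i eq)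
    ... | false = clauseOf-sat ls A∈ eq

    M-sat : IsModel τ → ∀ t → clauseSat τ (M t)
    M-sat (a→u , u→w) t with τ W in eq
    ... | true  = clauseOf-sat (M-lits t) (here refl) eq
    ... | false with ¬∀⟶∃¬ n (λ i → τ (U i) ≡ true) (λ i → τ (U i) Bool.≟ true)
                       (λ all-u → case u→w all-u of λ ())
    ... | j , ¬uj = clauseOf-sat (M-lits t) (pick∈M t j) (pick-false (lookup t j))
      where
      pick-false : ∀ b → τ (var j (kind b)) ≡ false
      pick-false true  = ¬-not ¬uj
      pick-false false = ¬-not (λ aj → ¬uj (a→u j aj))

    φ₁-sat : IsModel τ → cnfSat τ φ₁
    φ₁-sat model = M-sat model allTrue All.∷ All.tabulate E-sat
      where
      E-sat : ∀ {C} → C ∈ₗ map E (allFin n) → clauseSat τ C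
      E-sat C∈ with ∈-map⁻ E C∈
      ... | i , _ , refl = A→U-sat model (E-lits i) (here refl) (there (here refl))

    φ₂-sat : IsModel τ → cnfSat τ φ₂
    φ₂-sat model = All.tabulate clause-sat
      where
      code-sat : ∀ c → clauseSat τ ⟦ c ⟧
      code-sat (dp i) = A→U-sat model (DP-lits i) (there (here refl)) (there (there (here refl)))
      code-sat (dn i) = A→U-sat model (DN-lits i) (there (here refl)) (there (there (here refl)))
      code-sat (mt t) = M-sat model t
      clause-sat : ∀ {C} → C ∈ₗ φ₂ → clauseSat τ C
      clause-sat C∈ with ∈-map⁻ ⟦_⟧ C∈
      ... | c , _ , refl = code-sat c

    K-sound : clauseSat τ K → (∀ i → τ (U i) ≡ true) → τ W ≡ true
    K-sound sat all-u with clauseOf-sat⁻ (M-lits allTrue) sat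
    ... | _ , here refl , w-true = w-true
    ... | _ , there l∈ , l-false with ∈-map⁻ _ l∈
    ...   | j , _ , refl = ⊥-elim (not-¬ l-false (trans (cong τ (pick-allTrue j)) (all-u j)))

    E-sound : ∀ i → clauseSat τ (E i) → τ (A i) ≡ true → τ (U i) ≡ true
    E-sound i sat a-true with clauseOf-sat⁻ (E-lits i) sat
    ... | _ , here refl , u-true                = u-true
    ... | _ , there (here refl) , a-false       = ⊥-elim (not-¬ a-false a-true)

    DP-DN-sound : ∀ i → clauseSat τ (DP i) → clauseSat τ (DN i) → τ (A i) ≡ true → τ (U i) ≡ true
    DP-DN-sound i satP satN a-true with clauseOf-sat⁻ (DP-lits i) satP | clauseOf-sat⁻ (DN-lits i) satN
    ... | _ , there (here refl) , u-true | _ = u-true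
    ... | _ | _ , there (here refl) , u-true = u-true
    ... | _ , there (there (here refl)) , a-false | _ = ⊥-elim (not-¬ a-false a-true)
    ... | _ | _ , there (there (here refl)) , a-false = ⊥-elim (not-¬ a-false a-true)
    ... | _ , here refl , b-true | _ , here refl , b-false = ⊥-elim (not-¬ b-false b-true)

    φ₁-model : cnfSat τ φ₁ → IsModel τ
    φ₁-model sat = (λ i → E-sound i (All.lookup sat (E∈φ₁ i))) , K-sound (All.lookup sat (here refl))

    φ₂-model : cnfSat τ φ₂ → IsModel τ
    φ₂-model sat = (λ i → DP-DN-sound i (All.lookup sat (DP∈φ₂ i)) (All.lookup sat (DN∈φ₂ i)))
                 , K-sound (All.lookup sat (M∈φ₂ allTrue refl))

  φ₁≈φ₂ : Equivalent φ₁ φ₂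
  φ₁≈φ₂ τ = (λ sat → φ₂-sat (φ₁-model sat)) , (λ sat → φ₁-sat (φ₂-model sat))

  assignment : Bool → (Fin n → Fin 3 → Bool) → Assignment numVars
  assignment w f zero    = w
  assignment w f (suc y) = uncurry f (remQuot 3 y)

  assignment-var : ∀ w f i k → assignment w f (var i k) ≡ f i k
  assignment-var w f i k = cong (uncurry f) (remQuot-combine i k)

  indicator : Fin n → Fin n → Bool
  indicator j i = does (i ≟ j)

  data VarView : Fin numVars → Set where
    w-view   : VarView W
    var-view : ∀ i k → VarView (var i k)

  viewVar : ∀ x → VarView x
  viewVar zero    = w-view
  viewVar (suc y) = subst (λ z → VarView (suc z)) (combine-remQuot {n} 3 y) (var-view _ _)

  module Under (α : PartialAssignment numVars) where

    open Completion α

    Covered : Fin n → Set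
    Covered i = A i ⁺ ∈ᵅ α ⊎ U i ⁺ ∈ᵅ α

    covered? : ∀ i → Dec (Covered i)
    covered? i = (A i ∈? posA α) ⊎-dec (U i ∈? posA α)

    data Conflict : Set where
      a∧¬u       : ∀ i → A i ⁺ ∈ᵅ α → U i ⁻ ∈ᵅ α → Conflict
      ¬w∧covered : W ⁻ ∈ᵅ α → (∀ i → Covered i) → Conflict

    conflict? : Dec Conflict
    conflict? with any? (λ i → (A i ∈? posA α) ×-dec (U i ∈? negA α)) | W ∈? negA α | all? covered?
    ... | yes (i , a , ¬u) | _      | _       = yes (a∧¬u i a ¬u)
    ... | no _             | yes ¬w | yes cov = yes (¬w∧covered ¬w cov)
    ... | no ¬a∧¬u         | no ¬¬w | _       =
      no λ { (a∧¬u i a ¬u) → ¬a∧¬u (i , a , ¬u) ; (¬w∧covered ¬w _) → ¬¬w ¬w }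
    ... | no ¬a∧¬u         | _      | no ¬cov =
      no λ { (a∧¬u i a ¬u) → ¬a∧¬u (i , a , ¬u) ; (¬w∧covered _ cov) → ¬cov cov }

    defaults : (Fin n → Bool) → Bool → Fin n → Fin 3 → Bool
    defaults R b i kA = R i
    defaults R b i kB = b
    defaults R b i kU = R i ∨ valueOr (R i) (A i)

    counterModel : Bool → (Fin n → Bool) → Bool → Assignment numVars
    counterModel w R b = override (assignment w (defaults R b))

    WJustified : Bool → (Fin n → Bool) → Set
    WJustified w R = (W ⁻ ∉ᵅ α × w ≡ true) ⊎ (∃ λ i → ¬ Covered i × R i ≡ false)

    module _ {w : Bool} {R : Fin n → Bool} {b : Bool} where

      private
        τ : Assignment numVars
        τ = counterModel w R b

      τ-A : ∀ i → τ (A i) ≡ valueOr (R i) (A i)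
      τ-A i = cong (λ d → valueOr d (A i)) (assignment-var w (defaults R b) i kA)

      τ-B : ∀ i → τ (B i) ≡ valueOr b (B i)
      τ-B i = cong (λ d → valueOr d (B i)) (assignment-var w (defaults R b) i kB)

      τ-U : ∀ i → τ (U i) ≡ valueOr (R i ∨ τ (A i)) (U i)
      τ-U i = cong (λ d → valueOr d (U i)) (trans (assignment-var w (defaults R b) i kU) (cong (R i ∨_) (sym (τ-A i))))

      uncovered-false : ∀ i → ¬ Covered i → R i ≡ false → τ (U i) ≡ false
      uncovered-false i uncovered Ri≡false = begin
        τ (U i)                       ≡⟨ τ-U i ⟩
        valueOr (R i ∨ τ (A i)) (U i) ≡⟨ cong (λ d → valueOr (d ∨ τ (A i)) (U i)) Ri≡false ⟩
        valueOr (τ (A i)) (U i)       ≡⟨ cong (λ d → valueOr d (U i)) a-false ⟩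
        valueOr false (U i)           ≡⟨ valueOr-false (U i) (λ u⁺ → uncovered (inj₂ u⁺)) ⟩
        false                         ∎
        where
        open ≡-Reasoning
        a-false : τ (A i) ≡ false
        a-false = trans (τ-A i) (trans (cong (λ d → valueOr d (A i)) Ri≡false)
                                       (valueOr-false (A i) (λ a⁺ → uncovered (inj₁ a⁺))))

      counterModel-isModel : ¬ Conflict → (∀ i → R i ≡ true → U i ⁻ ∉ᵅ α) → WJustified w R → IsModel τ
      counterModel-isModel ¬conflict raisable justified = a→u , u→w justified
        where
        a→u : ∀ i → τ (A i) ≡ true → τ (U i) ≡ true
        a→u i a-true = by-status (status (U i))
          where
          by-status : Status (U i) → τ (U i) ≡ true
          by-status (assigned true u⁺) = trans (τ-U i) (valueOr-agrees _ (U i) true u⁺)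
          by-status (unassigned u⁺∉ u⁻∉) =
            trans (τ-U i) (trans (valueOr-unassigned _ (U i) u⁺∉ u⁻∉) (trans (cong (R i ∨_) a-true) (∨-zeroʳ (R i))))
          by-status (assigned false u⁻) with valueOr-true (R i) (A i) (trans (sym (τ-A i)) a-true)
          ... | inj₁ a⁺      = ⊥-elim (¬conflict (a∧¬u i a⁺ u⁻))
          ... | inj₂ Ri≡true = ⊥-elim (raisable i Ri≡true u⁻)
        u→w : WJustified w R → (∀ i → τ (U i) ≡ true) → τ W ≡ true
        u→w (inj₁ (w⁻∉ , refl)) _ = valueOr-avoids W false w⁻∉
        u→w (inj₂ (i , uncovered , Ri≡false)) all-u =
          ⊥-elim (not-¬ (uncovered-false i uncovered Ri≡false) (all-u i))

    OthersCovered : Fin n → Set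
    OthersCovered j = ∀ i → i ≢ j → Covered i

    othersCovered? : ∀ j → Dec (OthersCovered j)
    othersCovered? j = all? (λ i → ¬? (i ≟ j) →-dec covered? i)

    indicator-raisable : ∀ j → U j ⁻ ∉ᵅ α → ∀ i → indicator j i ≡ true → U i ⁻ ∉ᵅ α
    indicator-raisable j u⁻∉ i eq with i ≟ j
    ... | yes refl = u⁻∉

    none : Fin n → Bool
    none _ = false

    none-raisable : ∀ i → none i ≡ true → U i ⁻ ∉ᵅ α
    none-raisable i ()

    base-justified : ¬ Conflict → WJustified true none
    base-justified ¬conflict with W ∈? negA α
    ... | no w⁻∉ = inj₁ (w⁻∉ , refl)
    ... | yes w⁻ with ¬∀⟶∃¬ n Covered covered? (λ cov → ¬conflict (¬w∧covered w⁻ cov))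
    ...   | i , uncovered = inj₂ (i , uncovered , refl)

    indicator-justified : ∀ j → ¬ (W ⁻ ∈ᵅ α × OthersCovered j) → WJustified true (indicator j)
    indicator-justified j ¬forced with W ∈? negA α
    ... | no w⁻∉ = inj₁ (w⁻∉ , refl)
    ... | yes w⁻ with ¬∀⟶∃¬ n (λ i → i ≢ j → Covered i) (λ i → ¬? (i ≟ j) →-dec covered? i)
                              (λ cov → ¬forced (w⁻ , cov))
    ...   | i , ¬implication =
      inj₂ (i , (λ cov → ¬implication (λ _ → cov)) ,
            dec-false (i ≟ j) (λ i≡j → ¬implication (λ i≢j → ⊥-elim (i≢j i≡j))))

    φ₁⊢U : ∀ i → Covered i → φ₁ ∧ α ⊢₁ unit (U i ⁺)
    φ₁⊢U i (inj₂ u⁺) = fromα {l = U i ⁺} u⁺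
    φ₁⊢U i (inj₁ a⁺) = ⊢₁-propagate (E-lits i) (E∈φ₁ i) (here refl) λ where
      _ (here refl)         ne → ⊥-elim (ne refl)
      _ (there (here refl)) _  → fromα {l = A i ⁺} a⁺
      _ (there (there ()))  _

    φ₁⊢pick : ∀ i → Covered i → φ₁ ∧ α ⊢₁ unit (pick allTrue i ⁺)
    φ₁⊢pick i cov = subst (λ x → φ₁ ∧ α ⊢₁ unit (x ⁺)) (sym (pick-allTrue i)) (φ₁⊢U i cov)

    φ₁⊢W : (∀ i → Covered i) → φ₁ ∧ α ⊢₁ unit (W ⁺)
    φ₁⊢W cov = ⊢₁-propagate (M-lits allTrue) (here refl) (here refl) (λ where
      _ (here refl) ne → ⊥-elim (ne refl)
      _ (there l∈)  _  → refute l∈)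
      where
      refute : ∀ {l} → l ∈ₗ map (λ j → pick allTrue j ⁻) (allFin n) → φ₁ ∧ α ⊢₁ unit (neg l)
      refute l∈ with ∈-map⁻ _ l∈
      ... | i , _ , refl = φ₁⊢pick i (cov i)

    φ₁⊢¬U : ∀ j → W ⁻ ∈ᵅ α → OthersCovered j → φ₁ ∧ α ⊢₁ unit (U j ⁻)
    φ₁⊢¬U j w⁻ cov = subst (λ x → φ₁ ∧ α ⊢₁ unit (x ⁻)) (pick-allTrue j)
      (⊢₁-propagate (M-lits allTrue) (here refl) (pick∈M allTrue j) λ where
        _ (here refl) _  → fromα {l = W ⁻} w⁻
        _ (there l∈)  ne → refute l∈ ne)
      where
      refute : ∀ {l} → l ∈ₗ map (λ j → pick allTrue j ⁻) (allFin n) → l ≢ pick allTrue j ⁻ → φ₁ ∧ α ⊢₁ unit (neg l)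
      refute l∈ ne with ∈-map⁻ _ l∈
      ... | i , _ , refl = φ₁⊢pick i (cov i (λ { refl → ne refl }))

    φ₁⊢¬A : ∀ j → φ₁ ∧ α ⊢₁ unit (U j ⁻) → φ₁ ∧ α ⊢₁ unit (A j ⁻)
    φ₁⊢¬A j ⊢¬u = ⊢₁-propagate (E-lits j) (E∈φ₁ j) (there (here refl)) λ where
      _ (here refl)         _  → ⊢¬u
      _ (there (here refl)) ne → ⊥-elim (ne refl)
      _ (there (there ()))  _

    φ₁⊢conflict : Conflict → φ₁ ∧ α ⊢₁ emptyClause
    φ₁⊢conflict (a∧¬u i a⁺ u⁻)       = ⊢₁-contradiction (U i ⁺) (φ₁⊢U i (inj₁ a⁺)) (fromα {l = U i ⁻} u⁻)
    φ₁⊢conflict (¬w∧covered w⁻ cov) = ⊢₁-contradiction (W ⁺) (φ₁⊢W cov) (fromα {l = W ⁻} w⁻)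

    module NoConflict (¬conflict : ¬ Conflict) where

      ⊭-counterModel : ∀ {w R b} x c → (∀ i → R i ≡ true → U i ⁻ ∉ᵅ α) → WJustified w R →
                       counterModel w R b x ≡ not c → ¬ φ₁ ∧ α ⊨ (x , c)
      ⊭-counterModel {w} {R} {b} x c raisable justified τx≡¬c ⊨l =
        not-¬ (⊨l τ (φ₁-sat (counterModel-isModel ¬conflict raisable justified)) (override-extends _)) τx≡¬c
        where
        τ : Assignment numVars
        τ = counterModel w R b

      ⊭-raised : ∀ i x c → U i ⁻ ∉ᵅ α → ¬ (W ⁻ ∈ᵅ α × OthersCovered i) →
                 counterModel true (indicator i) false x ≡ not c → ¬ φ₁ ∧ α ⊨ (x , c)
      ⊭-raised i x c u⁻∉ ¬forced =
        ⊭-counterModel x c (indicator-raisable i u⁻∉) (indicator-justified i ¬forced)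

      τ-raised-A : ∀ i → A i ⁻ ∉ᵅ α → counterModel true (indicator i) false (A i) ≡ true
      τ-raised-A i a⁻∉ = trans (τ-A {true} {indicator i} {false} i)
        (trans (cong (λ d → valueOr d (A i)) (dec-true (i ≟ i) refl)) (valueOr-avoids (A i) false a⁻∉))

      τ-raised-U : ∀ i → U i ⁻ ∉ᵅ α → counterModel true (indicator i) false (U i) ≡ true
      τ-raised-U i u⁻∉ = trans (τ-U {true} {indicator i} {false} i)
        (trans (cong (λ d → valueOr (d ∨ counterModel true (indicator i) false (A i)) (U i)) (dec-true (i ≟ i) refl))
               (valueOr-avoids (U i) false u⁻∉))

      W-implied : ∀ c → (W , c) ∉ᵅ α → φ₁ ∧ α ⊨ (W , c) → φ₁ ∧ α ⊢₁ unit (W , c)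
      W-implied false w⁻∉ ⊨l = ⊥-elim
        (⊭-counterModel {true} {none} {false} W false none-raisable (inj₁ (w⁻∉ , refl)) (valueOr-avoids W false w⁻∉) ⊨l)
      W-implied true  w⁺∉ ⊨l with all? covered?
      ... | yes cov = φ₁⊢W cov
      ... | no ¬cov with ¬∀⟶∃¬ n Covered covered? ¬cov
      ...   | i , uncovered = ⊥-elim (⊭-counterModel {false} {none} {false} W true none-raisable
                                        (inj₂ (i , uncovered , refl)) (valueOr-avoids W true w⁺∉) ⊨l)

      B-not-implied : ∀ i c → (B i , c) ∉ᵅ α → ¬ φ₁ ∧ α ⊨ (B i , c)
      B-not-implied i c b∉ = ⊭-counterModel {true} {none} {not c} (B i) c none-raisable (base-justified ¬conflict)
                               (trans (τ-B {true} {none} {not c} i) (valueOr-avoids (B i) c b∉))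

      A-implied : ∀ i c → (A i , c) ∉ᵅ α → φ₁ ∧ α ⊨ (A i , c) → φ₁ ∧ α ⊢₁ unit (A i , c)
      A-implied i true a⁺∉ ⊨l = ⊥-elim
        (⊭-counterModel {true} {none} {false} (A i) true none-raisable (base-justified ¬conflict)
                        (trans (τ-A {true} {none} {false} i) (valueOr-avoids (A i) true a⁺∉)) ⊨l)
      A-implied i false a⁻∉ ⊨l with U i ⁻ ∈ᵅ? α | (W ∈? negA α) ×-dec othersCovered? i
      ... | yes u⁻ | _              = φ₁⊢¬A i (fromα {l = U i ⁻} u⁻)
      ... | no _   | yes (w⁻ , cov) = φ₁⊢¬A i (φ₁⊢¬U i w⁻ cov)
      ... | no u⁻∉ | no ¬forced     = ⊥-elim (⊭-raised i (A i) false u⁻∉ ¬forced (τ-raised-A i a⁻∉) ⊨l)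

      U-implied : ∀ i c → (U i , c) ∉ᵅ α → φ₁ ∧ α ⊨ (U i , c) → φ₁ ∧ α ⊢₁ unit (U i , c)
      U-implied i true _ ⊨l with covered? i
      ... | yes cov       = φ₁⊢U i cov
      ... | no uncovered  = ⊥-elim (⊭-counterModel {true} {none} {false} (U i) true none-raisable
                              (base-justified ¬conflict) (uncovered-false {true} {none} {false} i uncovered refl) ⊨l)
      U-implied i false u⁻∉ ⊨l with (W ∈? negA α) ×-dec othersCovered? i
      ... | yes (w⁻ , cov) = φ₁⊢¬U i w⁻ cov
      ... | no ¬forced     = ⊥-elim (⊭-raised i (U i) false u⁻∉ ¬forced (τ-raised-U i u⁻∉) ⊨l)

      implied⇒⊢₁ : ∀ x c → (x , c) ∉ᵅ α → φ₁ ∧ α ⊨ (x , c) → φ₁ ∧ α ⊢₁ unit (x , c)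
      implied⇒⊢₁ x c with viewVar x
      ... | w-view        = W-implied c
      ... | var-view i kA = A-implied i c
      ... | var-view i kB = λ b∉ ⊨l → ⊥-elim (B-not-implied i c b∉ ⊨l)
      ... | var-view i kU = U-implied i c

    φ₁-pc : ∀ l → φ₁ ∧ α ⊨ l → (φ₁ ∧ α ⊢₁ unit l) ⊎ (φ₁ ∧ α ⊢₁ emptyClause)
    φ₁-pc (x , c) ⊨l with conflict? | (x , c) ∈ᵅ? α
    ... | yes conflict | _      = inj₂ (φ₁⊢conflict conflict)
    ... | no _         | yes l∈ = inj₁ (fromα {l = x , c} l∈)
    ... | no ¬conflict | no l∉  = inj₁ (NoConflict.implied⇒⊢₁ ¬conflict x c l∉ ⊨l)

    φ₂⊢⊥-A∧¬U : ∀ i → φ₂ ∧ α ⊢₁ unit (A i ⁺) → φ₂ ∧ α ⊢₁ unit (U i ⁻) → φ₂ ∧ α ⊢₁ emptyClause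
    φ₂⊢⊥-A∧¬U i ⊢a ⊢¬u = ⊢₁-contradiction (B i ⁺)
      (⊢₁-propagate (DP-lits i) (DP∈φ₂ i) (here refl) refute)
      (⊢₁-propagate (DN-lits i) (DN∈φ₂ i) (here refl) refute)
      where
      refute : ∀ {b} l → l ∈ₗ (B i , b) ∷ U i ⁺ ∷ A i ⁻ ∷ [] → l ≢ (B i , b) → φ₂ ∧ α ⊢₁ unit (neg l)
      refute _ (here refl)                 ne = ⊥-elim (ne refl)
      refute _ (there (here refl))         _  = ⊢¬u
      refute _ (there (there (here refl))) _  = ⊢a
      refute _ (there (there (there ())))  _

    module ¬W∧Covered (w⁻ : W ⁻ ∈ᵅ α) (cov : ∀ i → Covered i) where

      uTrue : Vec Bool n
      uTrue = tabulate (λ i → does (U i ∈? posA α))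

      picked : ∀ j → pick uTrue j ⁺ ∈ᵅ α
      picked j = subst (λ b → var j (kind b) ∈ₛ posA α) (sym (lookup∘tabulate _ j)) (from (U j ∈? posA α))
        where
        from : (d : Dec (U j ⁺ ∈ᵅ α)) → var j (kind (does d)) ∈ₛ posA α
        from (yes u⁺) = u⁺
        from (no u⁺∉) with cov j
        ... | inj₁ a⁺ = a⁺
        ... | inj₂ u⁺ = ⊥-elim (u⁺∉ u⁺)

      refute-M : ∀ t l → l ∈ₗ M-lits t → (∀ k → l ≡ pick t k ⁻ → pick t k ≡ pick uTrue k) →
                 φ₂ ∧ α ⊢₁ unit (neg l)
      refute-M t l (here refl) _ = fromα {l = W ⁻} w⁻
      refute-M t l (there l∈) same with ∈-map⁻ _ l∈
      ... | k , _ , refl = fromα {l = pick t k ⁺} (subst (λ x → x ∈ₛ posA α) (sym (same k refl)) (picked k))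

      even-refutation : parity uTrue ≡ parity allTrue → φ₂ ∧ α ⊢₁ emptyClause
      even-refutation even = ⊢₁-falsify (M-lits uTrue) (M∈φ₂ uTrue even) (λ l l∈ → refute-M uTrue l l∈ (λ _ _ → refl))

      odd-refutation : parity uTrue ≢ parity allTrue → φ₂ ∧ α ⊢₁ emptyClause
      odd-refutation odd = φ₂⊢⊥-A∧¬U j (fromα {l = A j ⁺} a⁺) ⊢¬u
        where
        j : Fin n
        j = proj₁ (∃-false uTrue (λ e → odd (cong parity e)))
        tj : lookup uTrue j ≡ false
        tj = proj₂ (∃-false uTrue (λ e → odd (cong parity e)))
        a⁺ : A j ⁺ ∈ᵅ α
        a⁺ = subst (λ b → var j (kind b) ∈ₛ posA α) tj (picked j)
        s : Vec Bool n
        s = uTrue [ j ]≔ true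
        s-even : parity s ≡ parity allTrue
        s-even = trans (parity-[]≔true uTrue j tj) (trans (cong not (¬-not odd)) (not-involutive _))
        ⊢¬u : φ₂ ∧ α ⊢₁ unit (U j ⁻)
        ⊢¬u = subst (λ b → φ₂ ∧ α ⊢₁ unit (var j (kind b) ⁻)) (lookup∘update j uTrue true)
          (⊢₁-propagate (M-lits s) (M∈φ₂ s s-even) (pick∈M s j)
            (λ l l∈ l≢ → refute-M s l l∈ λ k e →
              cong (λ b → var k (kind b)) (lookup∘update′ (λ { refl → l≢ e }) uTrue true)))

    φ₂-urc : φ₂ ∧ α ⊨⊥ → φ₂ ∧ α ⊢₁ emptyClause
    φ₂-urc unsat with conflict?
    ... | yes (a∧¬u i a⁺ u⁻)       = φ₂⊢⊥-A∧¬U i (fromα {l = A i ⁺} a⁺) (fromα {l = U i ⁻} u⁻)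
    ... | yes (¬w∧covered w⁻ cov) with parity (¬W∧Covered.uTrue w⁻ cov) Bool.≟ parity allTrue
    ...   | yes even = ¬W∧Covered.even-refutation w⁻ cov even
    ...   | no odd   = ¬W∧Covered.odd-refutation w⁻ cov odd
    φ₂-urc unsat | no ¬c =
      ⊥-elim (unsat _ (φ₂-sat (counterModel-isModel {true} {none} {false} ¬c none-raisable (base-justified ¬c)))
                    (override-extends (assignment true (defaults none false))))

  φ₁-PC : PC φ₁
  φ₁-PC α = Under.φ₁-pc α

  φ₂-URC : URC φ₂
  φ₂-URC α = Under.φ₂-urc α

  removal-changes-function : ∀ p c (τ : Assignment numVars) → List.lookup φ₂ p ≡ ⟦ c ⟧ →
                             (∀ c′ → c′ ≢ c → clauseSat τ ⟦ c′ ⟧) → ¬ clauseSat τ ⟦ c ⟧ →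
                             ¬ Equivalent (removeAt φ₂ p) φ₂
  removal-changes-function p c τ eq others violated =
    ¬Equivalent-removeAt τ φ₂-unique p sat (subst (λ C → ¬ clauseSat τ C) (sym eq) violated)
    where
    sat : ∀ C → C ∈ₗ φ₂ → C ≢ List.lookup φ₂ p → clauseSat τ C
    sat C C∈ C≢ with ∈-map⁻ ⟦_⟧ C∈
    ... | c′ , _ , refl = others c′ (λ { refl → C≢ (sym eq) })

  dp-witness dn-witness : Fin n → Fin n → Fin 3 → Bool
  dp-witness j i kA = indicator j i
  dp-witness j i kB = false
  dp-witness j i kU = false
  dn-witness j i kA = indicator j i
  dn-witness j i kB = indicator j i
  dn-witness j i kU = false

  K-witness : Fin n → Fin 3 → Bool
  K-witness i kA = false
  K-witness i kB = false
  K-witness i kU = true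

  module _ (j : Fin n) where

    private
      τ : Assignment numVars
      τ = assignment true (dp-witness j)

    dp-witness-others : ∀ c → c ≢ dp j → clauseSat τ ⟦ c ⟧
    dp-witness-others (dp i) c≢ = clauseOf-sat (DP-lits i) (there (there (here refl)))
      (trans (assignment-var true (dp-witness j) i kA) (dec-false (i ≟ j) (λ { refl → c≢ refl })))
    dp-witness-others (dn i) _ = clauseOf-sat (DN-lits i) (here refl) (assignment-var true (dp-witness j) i kB)
    dp-witness-others (mt t) _ = clauseOf-sat (M-lits t) (here refl) refl

    dp-witness-violates : ¬ clauseSat τ (DP j)
    dp-witness-violates sat with clauseOf-sat⁻ (DP-lits j) sat
    ... | _ , here refl , b-true                 = not-¬ (assignment-var true (dp-witness j) j kB) b-true
    ... | _ , there (here refl) , u-true         = not-¬ (assignment-var true (dp-witness j) j kU) u-true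
    ... | _ , there (there (here refl)) , a-false =
      not-¬ (trans (assignment-var true (dp-witness j) j kA) (dec-true (j ≟ j) refl)) a-false

  module _ (j : Fin n) where

    private
      τ : Assignment numVars
      τ = assignment true (dn-witness j)

    dn-witness-others : ∀ c → c ≢ dn j → clauseSat τ ⟦ c ⟧
    dn-witness-others (dp i) _ with i ≟ j
    ... | yes refl = clauseOf-sat (DP-lits j) (here refl)
                       (trans (assignment-var true (dn-witness j) j kB) (dec-true (j ≟ j) refl))
    ... | no i≢j   = clauseOf-sat (DP-lits i) (there (there (here refl)))
                       (trans (assignment-var true (dn-witness j) i kA) (dec-false (i ≟ j) i≢j))
    dn-witness-others (dn i) c≢ = clauseOf-sat (DN-lits i) (there (there (here refl)))
      (trans (assignment-var true (dn-witness j) i kA) (dec-false (i ≟ j) (λ { refl → c≢ refl })))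
    dn-witness-others (mt t) _ = clauseOf-sat (M-lits t) (here refl) refl

    dn-witness-violates : ¬ clauseSat τ (DN j)
    dn-witness-violates sat with clauseOf-sat⁻ (DN-lits j) sat
    ... | _ , here refl , b-false                =
      not-¬ (trans (assignment-var true (dn-witness j) j kB) (dec-true (j ≟ j) refl)) b-false
    ... | _ , there (here refl) , u-true         = not-¬ (assignment-var true (dn-witness j) j kU) u-true
    ... | _ , there (there (here refl)) , a-false =
      not-¬ (trans (assignment-var true (dn-witness j) j kA) (dec-true (j ≟ j) refl)) a-false

  private
    τK : Assignment numVars
    τK = assignment false K-witness

  K-witness-others : ∀ c → c ≢ mt allTrue → clauseSat τK ⟦ c ⟧
  K-witness-others (dp i) _ = clauseOf-sat (DP-lits i) (there (there (here refl))) (assignment-var false K-witness i kA)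
  K-witness-others (dn i) _ = clauseOf-sat (DN-lits i) (there (there (here refl))) (assignment-var false K-witness i kA)
  K-witness-others (mt t) c≢ with ∃-false t (λ { refl → c≢ refl })
  ... | j , tj = clauseOf-sat (M-lits t) (pick∈M t j)
                   (trans (cong (λ b → τK (var j (kind b))) tj) (assignment-var false K-witness j kA))

  K-witness-violates : ¬ clauseSat τK K
  K-witness-violates sat with clauseOf-sat⁻ (M-lits allTrue) sat
  ... | _ , here refl , ()
  ... | _ , there l∈ , pick-false with ∈-map⁻ _ l∈
  ...   | j , _ , refl =
    not-¬ pick-false (trans (cong τK (pick-allTrue j)) (assignment-var false K-witness j kU))

  module Without-M (s : Vec Bool n) (s≢allTrue : s ≢ allTrue) (s-even : parity s ≡ parity allTrue)
                   (p : Fin (length φ₂)) (removed : List.lookup φ₂ p ≡ M s) where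

    ψ : CNF numVars
    ψ = removeAt φ₂ p

    ⟦⟧∈ψ : ∀ c → c ∈ₗ codes → c ≢ mt s → ⟦ c ⟧ ∈ₗ ψ
    ⟦⟧∈ψ c c∈ c≢ = ∈-removeAt⁺ φ₂ p (∈-map⁺ ⟦_⟧ c∈) (λ e → c≢ (⟦⟧-injective (trans e removed)))

    ρ-lits : List (Lit numVars)
    ρ-lits = W ⁻ ∷ map (λ j → pick s j ⁺) (allFin n)

    ρ-noClash : ∀ x → x ⁺ ∈ₗ ρ-lits → x ⁻ ∈ₗ ρ-lits → ⊥
    ρ-noClash x (there x⁺∈) (here refl) with ∈-map⁻ _ x⁺∈
    ... | _ , _ , e = W≢var (cong proj₁ e)
    ρ-noClash x (there _) (there x⁻∈) with ∈-map⁻ _ x⁻∈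
    ... | _ , _ , ()

    ρ : PartialAssignment numVars
    ρ = fromLits ρ-lits ρ-noClash

    ρ-falsifies-M : ∀ l → l ∈ₗ M-lits s → neg l ∈ᵅ ρ
    ρ-falsifies-M l (here refl) = ∈ᵅ-fromLits⁺ ρ-lits ρ-noClash (here refl)
    ρ-falsifies-M l (there l∈) with ∈-map⁻ _ l∈
    ... | j , _ , refl = ∈ᵅ-fromLits⁺ ρ-lits ρ-noClash (there (∈-map⁺ _ (∈-allFin j)))

    ρ-unsat : ψ ∧ ρ ⊨⊥
    ρ-unsat τ sat τ-extends = extends-falsifies (M-lits s) τ-extends ρ-falsifies-M (M-sat model s)
      where
      model : IsModel τ
      model = (λ i → DP-DN-sound i (All.lookup sat (⟦⟧∈ψ (dp i) (dp∈codes i) (λ ())))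
                                   (All.lookup sat (⟦⟧∈ψ (dn i) (dn∈codes i) (λ ()))))
            , K-sound (All.lookup sat (⟦⟧∈ψ (mt allTrue) (mt∈codes allTrue refl) (λ { refl → s≢allTrue refl })))

    unassigned : ∀ i k c → k ≢ kind (lookup s i) → (var i k , c) ∉ᵅ ρ
    unassigned i k c k≢ l∈ with ∈ᵅ-fromLits⁻ ρ-lits ρ-noClash {var i k , c} l∈
    ... | here e  = W≢var (sym (cong proj₁ e))
    ... | there l∈′ with ∈-map⁻ _ l∈′
    ...   | j , _ , e with var-injective (cong proj₁ e)
    ...     | refl , k≡ = k≢ k≡

    Unassigned-var : ∀ i k c → k ≢ kind (lookup s i) → Unassigned ρ (var i k , c)
    Unassigned-var i k c k≢ = unassigned i k c k≢ , unassigned i k (not c) k≢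

    two-unassigned : ∀ c i b → lookup s i ≡ false → (B i , b) ∈ₗ lits c → U i ⁺ ∈ₗ lits c → Guarded ρ ⟦ c ⟧
    two-unassigned c i b si B∈ U∈ =
      inj₂ ((B i , b) , U i ⁺ , (λ e → kB≢kU (proj₂ (var-injective (cong proj₁ e)))) ,
            ∈ᶜ-clauseOf⁺ B∈ , ∈ᶜ-clauseOf⁺ U∈ ,
            Unassigned-var i kB b (kB≢kind _) , Unassigned-var i kU true (λ e → kU≢kA (trans e (cong kind si))))
      where
      kB≢kU : kB ≢ kU
      kB≢kU ()
      kU≢kA : kU ≢ kA
      kU≢kA ()

    U-assigned : ∀ c i → lookup s i ≡ true → U i ⁺ ∈ₗ lits c → Guarded ρ ⟦ c ⟧
    U-assigned c i si U∈ = inj₁ (U i ⁺ , ∈ᶜ-clauseOf⁺ U∈ ,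
      subst (λ b → (var i (kind b) , true) ∈ᵅ ρ) si (∈ᵅ-fromLits⁺ ρ-lits ρ-noClash (there (∈-map⁺ _ (∈-allFin i)))))

    guarded : ∀ C → C ∈ₗ ψ → Guarded ρ C
    guarded C C∈ with ∈-map⁻ ⟦_⟧ (∈-removeAt⁻ φ₂ p C∈)
    ... | dp i , _ , refl with lookup s i in si
    ...   | true  = U-assigned (dp i) i si (there (here refl))
    ...   | false = two-unassigned (dp i) i true si (here refl) (there (here refl))
    guarded C C∈ | dn i , _ , refl with lookup s i in si
    ...   | true  = U-assigned (dn i) i si (there (here refl))
    ...   | false = two-unassigned (dn i) i false si (here refl) (there (here refl))
    guarded C C∈ | mt t , t∈ , refl
      with ∃₂-differences t s (trans (mt∈codes⁻ t∈) (sym s-even))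
                              (λ { refl → lookup∉removeAt φ₂-unique p (subst (_∈ₗ ψ) (sym removed) C∈) })
    ... | j , j′ , j≢j′ , d , d′ =
      inj₂ (pick t j ⁻ , pick t j′ ⁻ , (λ e → j≢j′ (proj₁ (var-injective (cong proj₁ e)))) ,
            ∈ᶜ-clauseOf⁺ (pick∈M t j) , ∈ᶜ-clauseOf⁺ (pick∈M t j′) ,
            Unassigned-var j _ false (λ e → d (kind-injective e)) ,
            Unassigned-var j′ _ false (λ e → d′ (kind-injective e)))

    ¬URC : ¬ URC ψ
    ¬URC urc = ⊬₁-empty ρ guarded (urc ρ ρ-unsat)

  φ₂-irredundant : ∀ p → ¬ Equivalent (removeAt φ₂ p) φ₂ ⊎ ¬ URC (removeAt φ₂ p)
  φ₂-irredundant p with ∈-map⁻ ⟦_⟧ (∈-lookup p)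
  ... | dp j , _ , eq = inj₁ (removal-changes-function p (dp j) _ eq (dp-witness-others j) (dp-witness-violates j))
  ... | dn j , _ , eq = inj₁ (removal-changes-function p (dn j) _ eq (dn-witness-others j) (dn-witness-violates j))
  ... | mt t , t∈ , eq with Vec.≡-dec Bool._≟_ t allTrue
  ...   | yes refl = inj₁ (removal-changes-function p (mt allTrue) (assignment false K-witness) eq
                                                     K-witness-others K-witness-violates)
  ...   | no t≢    = inj₂ (Without-M.¬URC t t≢ (mt∈codes⁻ t∈) p eq)

  length-φ₁ : length φ₁ ≡ suc n
  length-φ₁ = cong suc (trans (length-map E (allFin n)) (length-tabulate id))

  vecsOfParity≤length-φ₂ : length (vecsOfParity n (parity allTrue)) ≤ length φ₂
  vecsOfParity≤length-φ₂ = begin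
    length vecs                                   ≡⟨ length-map mt vecs ⟨
    length (map mt vecs)                          ≤⟨ length-++-≤ʳ (map mt vecs) {map dn (allFin n)} ⟩
    length (map dn (allFin n) ++ map mt vecs)     ≤⟨ length-++-≤ʳ _ {map dp (allFin n)} ⟩
    length codes                                  ≡⟨ length-map ⟦_⟧ codes ⟨
    length φ₂                                     ∎
    where
    vecs : List (Vec Bool n)
    vecs = vecsOfParity n (parity allTrue)
    open ≤-Reasoning

suc≤2* : ∀ {n} → 1 ≤ n → suc n ≤ 2 * n
suc≤2* {n} 1≤n = subst (suc n ≤_) (cong (n +_) (sym (+-identityʳ n))) (+-monoˡ-≤ n 1≤n)

2^[2+k]≤[2^[1+k]]² : ∀ k {s} → 2 ^ suc k ≤ s → 2 ^ suc (suc k) ≤ s ^ 2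
2^[2+k]≤[2^[1+k]]² k {s} 2^[1+k]≤s = begin
  2 * 2 ^ suc k           ≤⟨ *-monoˡ-≤ (2 ^ suc k) 2≤2^[1+k] ⟩
  2 ^ suc k * 2 ^ suc k   ≡⟨ cong (2 ^ suc k *_) (sym (*-identityʳ (2 ^ suc k))) ⟩
  (2 ^ suc k) ^ 2         ≤⟨ ^-monoˡ-≤ 2 2^[1+k]≤s ⟩
  s ^ 2                   ∎
  where
  open ≤-Reasoning
  2≤2^[1+k] : 2 ≤ 2 ^ suc k
  2≤2^[1+k] = *-monoʳ-≤ 2 (m^n>0 2 k)

length-φ₂-exponential : ∀ n → 2 ≤ n → 2 ^ n ≤ length (Construction.φ₂ n) ^ 2
length-φ₂-exponential (suc (suc k)) (s≤s (s≤s z≤n)) = 2^[2+k]≤[2^[1+k]]² k (begin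
  2 ^ suc k                                          ≡⟨ length-vecsOfParity (suc k) _ ⟨
  length (vecsOfParity (suc (suc k)) (parity allTrue)) ≤⟨ vecsOfParity≤length-φ₂ ⟩
  length φ₂                                          ∎)
  where
  open Construction (suc (suc k))
  open ≤-Reasoning

proposition1 : Σ ℕ λ c → Σ ℕ λ k → Σ ℕ λ N → ∀ n → 1 ≤ n →
    Σ ℕ λ m → Σ (CNF m) λ φ₁ → Σ (CNF m) λ φ₂ →
    IsCNF φ₁ × IsCNF φ₂ × PC φ₁ × Equivalent φ₁ φ₂ × URC-irredundant φ₂ ×
    size φ₁ ≤ c * n × (N ≤ n → 2 ^ n ≤ size φ₂ ^ k)
proposition1 = 2 , 2 , 2 , λ n 1≤n → let open Construction n in
  numVars , φ₁ , φ₂ , φ₁-unique , φ₂-unique , φ₁-PC , φ₁≈φ₂ , (φ₂-URC , φ₂-irredundant) ,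
  subst (_≤ 2 * n) (sym length-φ₁) (suc≤2* 1≤n) , length-φ₂-exponential n
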